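{- Let $G$ be a finite group, $N$ a normal subgroup of $G$, and $s : G/N \rightarrow G$ a section of the projection $G \rightarrow G/N$ with $s(1)=1$. Let $A$ be a $G$-module (group law written multiplicatively). Then every cohomology class in $H^2(G, A)$ contains a $2$-cocycle $\alpha$ such that $\alpha(n, s(\sigma)) = 1$ for all $n \in N$ and all $\sigma \in G/N$.
   Context: $2$-cocycles and coboundaries are inhomogeneous cochains for the group cohomology of the finite group $G$ acting on $A$. -}

module Defs where

open import Level using (Level; _⊔_; suc)
open import Algebra.Bundles using (Group; AbelianGroup)
open import Data.Nat using (ℕ)
open import Data.Fin using (Fin)
open import Data.Product using (Σ; ∃; _×_; _,_)

private
  variable
    c ℓ c′ ℓ′ p : Level

IsFiniteGroup : Group c ℓ → Set (c ⊔ ℓ)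
IsFiniteGroup G = ∃ λ (k : ℕ) → Σ (Fin k → Carrier) λ e → ∀ g → ∃ λ i → e i ≈ g
  where open Group G

record IsNormalSubgroup (G : Group c ℓ) (N : Group.Carrier G → Set p) : Set (c ⊔ ℓ ⊔ p) where
  open Group G
  field
    resp     : ∀ {x y} → x ≈ y → N x → N y
    ε-mem    : N ε
    ∙-mem    : ∀ {x y} → N x → N y → N (x ∙ y)
    ⁻¹-mem   : ∀ {x} → N x → N (x ⁻¹)
    conj-mem : ∀ g {x} → N x → N (g ∙ x ∙ g ⁻¹)

-- The coset relation defining G/N : g ~ h  iff  g⁻¹ h ∈ N  (i.e. gN = hN).
-- Elements of G/N are represented by elements of G, with equality _~_.
_~[_]_ : {G : Group c ℓ} → Group.Carrier G → (Group.Carrier G → Set p) → Group.Carrier G → Set p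
_~[_]_ {G = G} g N h = N ((g ⁻¹) ∙ h)
  where open Group G

-- A section s : G/N → G of the projection G → G/N with s(1) = 1.
-- As G/N is represented by the setoid (G, ~), s is a function G → G that is
-- well defined on cosets, lands in the given coset, and sends the identity coset to 1.
record IsNormalizedSection (G : Group c ℓ) (N : Group.Carrier G → Set p)
                           (s : Group.Carrier G → Group.Carrier G) : Set (c ⊔ ℓ ⊔ p) where
  open Group G
  field
    well-defined : ∀ {g h} → _~[_]_ {G = G} g N h → s g ≈ s h
    is-section   : ∀ g → _~[_]_ {G = G} (s g) N g
    s-one        : s ε ≈ ε

record GModule (G : Group c ℓ) (c′ ℓ′ : Level) : Set (c ⊔ ℓ ⊔ suc (c′ ⊔ ℓ′)) where
  module G = Group G
  field
    A    : AbelianGroup c′ ℓ′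
  open AbelianGroup A
  field
    _·_      : G.Carrier → Carrier → Carrier
    ·-cong   : ∀ {g h a b} → g G.≈ h → a ≈ b → (g · a) ≈ (h · b)
    ·-ε      : ∀ a → (G.ε · a) ≈ a
    ·-assoc  : ∀ g h a → ((g G.∙ h) · a) ≈ (g · (h · a))
    ·-hom    : ∀ g a b → (g · (a ∙ b)) ≈ ((g · a) ∙ (g · b))

module _ {G : Group c ℓ} (M : GModule G c′ ℓ′) where
  open GModule M
  open AbelianGroup A renaming (Carrier to |A|; _≈_ to _≈A_)

  record Cochain₁ : Set (c ⊔ ℓ ⊔ c′ ⊔ ℓ′) where
    field
      fun  : G.Carrier → |A|
      cong : ∀ {g g′} → g G.≈ g′ → fun g ≈A fun g′

  record Cochain₂ : Set (c ⊔ ℓ ⊔ c′ ⊔ ℓ′) where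
    field
      fun  : G.Carrier → G.Carrier → |A|
      cong : ∀ {g g′ h h′} → g G.≈ g′ → h G.≈ h′ → fun g h ≈A fun g′ h′

  IsCocycle₂ : Cochain₂ → Set (c ⊔ ℓ′)
  IsCocycle₂ α = ∀ g h k →
    ((g · fun h k) ∙ fun g (h G.∙ k)) ≈A (fun (g G.∙ h) k ∙ fun g h)
    where open Cochain₂ α

  δ₁ : Cochain₁ → G.Carrier → G.Carrier → |A|
  δ₁ f g h = ((g · fun h) ∙ (fun (g G.∙ h) ⁻¹)) ∙ fun g
    where open Cochain₁ f

  IsCoboundary₂ : Cochain₂ → Set (c ⊔ ℓ ⊔ c′ ⊔ ℓ′)
  IsCoboundary₂ α = Σ Cochain₁ λ f → ∀ g h → Cochain₂.fun α g h ≈A δ₁ f g h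

  Cohomologous₂ : Cochain₂ → Cochain₂ → Set (c ⊔ ℓ ⊔ c′ ⊔ ℓ′)
  Cohomologous₂ α β = Σ Cochain₁ λ f → ∀ g h →
    (Cochain₂.fun α g h ∙ (Cochain₂.fun β g h ⁻¹)) ≈A δ₁ f g h

-- First normalize β to β(g,1) = β(1,h) = 1 by dividing by the coboundary of a constant.
-- Writing g = n·s(gN) with n ∈ N, the 1-cochain f(g) = β(n, s(gN)) then satisfies
-- f(s σ) = f(n) = 1 and f(n·s σ) = β(n, s σ), so (β·δf)(n, s σ) = β(n, s σ)·f(n·s σ)⁻¹ = 1.
module Submission where

open import Defs
open import Level using (Level; _⊔_)
open import Algebra.Bundles using (Group; AbelianGroup)
open import Data.Product using (Σ; _×_; _,_)
import Algebra.Properties.Group as GroupProperties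
import Algebra.Properties.AbelianGroup as AbelianGroupProperties
import Algebra.Solver.CommutativeMonoid as CommutativeMonoidSolver
import Relation.Binary.Reasoning.Setoid as SetoidReasoning

module Cohomology {c ℓ c′ ℓ′ : Level} {G : Group c ℓ} (M : GModule G c′ ℓ′) where

  open GModule M
  open AbelianGroup A
  open GroupProperties group
    using (identityʳ-unique; inverseˡ-unique; ∙-cancelˡ; ∙-cancelʳ; //-rightDividesˡ; //-rightDividesʳ)
  open AbelianGroupProperties A using (xyx⁻¹≈y; ⁻¹-∙-comm)
  open CommutativeMonoidSolver commutativeMonoid using (solve; _⊜_; _⊕_)
  open SetoidReasoning setoid
  open Cochain₁ using () renaming (fun to fun₁; cong to cong₁)
  open Cochain₂ using () renaming (fun to fun₂; cong to cong₂)

  ·-ε-homo : ∀ g → g · ε ≈ ε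
  ·-ε-homo g = identityʳ-unique (g · ε) (g · ε) (begin
    (g · ε) ∙ (g · ε)  ≈⟨ ·-hom g ε ε ⟨
    g · (ε ∙ ε)        ≈⟨ ·-cong G.refl (identityˡ ε) ⟩
    g · ε              ∎)

  ·-⁻¹-homo : ∀ g a → g · (a ⁻¹) ≈ (g · a) ⁻¹
  ·-⁻¹-homo g a = inverseˡ-unique _ _ (begin
    (g · (a ⁻¹)) ∙ (g · a)  ≈⟨ ·-hom g _ _ ⟨
    g · (a ⁻¹ ∙ a)          ≈⟨ ·-cong G.refl (inverseˡ a) ⟩
    g · ε                   ≈⟨ ·-ε-homo g ⟩
    ε                       ∎)

  const₁ : Carrier → Cochain₁ M
  const₁ a = record { fun = λ _ → a ; cong = λ _ → refl }

  _∙₁_ : Cochain₁ M → Cochain₁ M → Cochain₁ M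
  f ∙₁ f′ = record
    { fun  = λ g → fun₁ f g ∙ fun₁ f′ g
    ; cong = λ e → ∙-cong (cong₁ f e) (cong₁ f′ e)
    }

  _∙₂_ : Cochain₂ M → Cochain₂ M → Cochain₂ M
  α ∙₂ β = record
    { fun  = λ g h → fun₂ α g h ∙ fun₂ β g h
    ; cong = λ e e′ → ∙-cong (cong₂ α e e′) (cong₂ β e e′)
    }

  coboundary₂ : Cochain₁ M → Cochain₂ M
  coboundary₂ f = record
    { fun  = δ₁ M f
    ; cong = λ e e′ → ∙-cong (∙-cong (·-cong e (cong₁ f e′)) (⁻¹-cong (cong₁ f (G.∙-cong e e′))))
                             (cong₁ f e)
    }

  ∙₂-isCocycle : ∀ α β → IsCocycle₂ M α → IsCocycle₂ M β → IsCocycle₂ M (α ∙₂ β)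
  ∙₂-isCocycle α β α-cocycle β-cocycle g h k = begin
    (g · (a h k ∙ b h k)) ∙ (a g hk ∙ b g hk)               ≈⟨ ∙-congʳ (·-hom g _ _) ⟩
    ((g · a h k) ∙ (g · b h k)) ∙ (a g hk ∙ b g hk)         ≈⟨ interchange _ _ _ _ ⟩
    ((g · a h k) ∙ a g hk) ∙ ((g · b h k) ∙ b g hk)         ≈⟨ ∙-cong (α-cocycle g h k) (β-cocycle g h k) ⟩
    (a (g G.∙ h) k ∙ a g h) ∙ (b (g G.∙ h) k ∙ b g h)       ≈⟨ interchange _ _ _ _ ⟩
    (a (g G.∙ h) k ∙ b (g G.∙ h) k) ∙ (a g h ∙ b g h)       ∎
    where
    a = fun₂ α
    b = fun₂ β
    hk = h G.∙ k
    interchange : ∀ w x y z → (w ∙ x) ∙ (y ∙ z) ≈ (w ∙ y) ∙ (x ∙ z)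
    interchange = solve 4 (λ w x y z → (w ⊕ x) ⊕ (y ⊕ z) ⊜ (w ⊕ y) ⊕ (x ⊕ z)) refl

  coboundary₂-isCocycle : ∀ f → IsCocycle₂ M (coboundary₂ f)
  coboundary₂-isCocycle f g h k = begin
    (g · (((h · F k) ∙ F hk ⁻¹) ∙ F h)) ∙ (((g · F hk) ∙ F (g G.∙ hk) ⁻¹) ∙ F g)
      ≈⟨ ∙-congʳ act ⟩
    ((a ∙ y ⁻¹) ∙ x) ∙ ((y ∙ d) ∙ e)
      ≈⟨ solve 6 (λ a x d e y y′ → ((a ⊕ y′) ⊕ x) ⊕ ((y ⊕ d) ⊕ e)
                                 ⊜ ((((a ⊕ x) ⊕ d) ⊕ e) ⊕ y′) ⊕ y)
                 refl a x d e y (y ⁻¹) ⟩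
    ((a ∙ x ∙ d ∙ e) ∙ y ⁻¹) ∙ y
      ≈⟨ //-rightDividesˡ y _ ⟩
    a ∙ x ∙ d ∙ e
      ≈⟨ //-rightDividesʳ z _ ⟨
    ((a ∙ x ∙ d ∙ e) ∙ z) ∙ z ⁻¹
      ≈⟨ solve 6 (λ a x d e z z′ → ((((a ⊕ x) ⊕ d) ⊕ e) ⊕ z) ⊕ z′
                                 ⊜ ((a ⊕ d) ⊕ z) ⊕ ((x ⊕ z′) ⊕ e))
                 refl a x d e z (z ⁻¹) ⟩
    ((a ∙ d) ∙ z) ∙ ((x ∙ z ⁻¹) ∙ e)
      ≈⟨ ∙-congʳ (∙-congʳ (∙-congˡ (⁻¹-cong (cong₁ f (G.sym (G.assoc g h k)))))) ⟩
    ((a ∙ F ((g G.∙ h) G.∙ k) ⁻¹) ∙ z) ∙ ((x ∙ z ⁻¹) ∙ e)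
      ∎
    where
    F = fun₁ f
    hk = h G.∙ k
    a = (g G.∙ h) · F k
    x = g · F h
    y = g · F hk
    z = F (g G.∙ h)
    d = F (g G.∙ hk) ⁻¹
    e = F g
    act : g · (((h · F k) ∙ F hk ⁻¹) ∙ F h) ≈ (a ∙ y ⁻¹) ∙ x
    act = begin
      g · (((h · F k) ∙ F hk ⁻¹) ∙ F h)           ≈⟨ ·-hom g _ _ ⟩
      (g · ((h · F k) ∙ F hk ⁻¹)) ∙ x             ≈⟨ ∙-congʳ (·-hom g _ _) ⟩
      ((g · (h · F k)) ∙ (g · (F hk ⁻¹))) ∙ x     ≈⟨ ∙-congʳ (∙-cong (sym (·-assoc g h _)) (·-⁻¹-homo g _)) ⟩
      (a ∙ y ⁻¹) ∙ x                              ∎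

  δ₁-homo : ∀ f f′ g h → δ₁ M (f ∙₁ f′) g h ≈ δ₁ M f g h ∙ δ₁ M f′ g h
  δ₁-homo f f′ g h = begin
    ((g · (F h ∙ F′ h)) ∙ (F gh ∙ F′ gh) ⁻¹) ∙ (F g ∙ F′ g)
      ≈⟨ ∙-congʳ (∙-cong (·-hom g _ _) (sym (⁻¹-∙-comm _ _))) ⟩
    (((g · F h) ∙ (g · F′ h)) ∙ (F gh ⁻¹ ∙ F′ gh ⁻¹)) ∙ (F g ∙ F′ g)
      ≈⟨ solve 6 (λ a a′ b b′ c c′ → ((a ⊕ a′) ⊕ (b ⊕ b′)) ⊕ (c ⊕ c′)
                                   ⊜ ((a ⊕ b) ⊕ c) ⊕ ((a′ ⊕ b′) ⊕ c′))
                 refl (g · F h) (g · F′ h) (F gh ⁻¹) (F′ gh ⁻¹) (F g) (F′ g) ⟩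
    δ₁ M f g h ∙ δ₁ M f′ g h
      ∎
    where
    F = fun₁ f
    F′ = fun₁ f′
    gh = g G.∙ h

  δ₁-const : ∀ a g h → δ₁ M (const₁ a) g h ≈ g · a
  δ₁-const a g h = begin
    ((g · a) ∙ a ⁻¹) ∙ a  ≈⟨ //-rightDividesˡ a _ ⟩
    g · a                 ∎

  ∙₂coboundary-cohomologous : ∀ β f → Cohomologous₂ M (β ∙₂ coboundary₂ f) β
  ∙₂coboundary-cohomologous β f = f , λ g h → xyx⁻¹≈y (fun₂ β g h) (δ₁ M f g h)

  cohomologous-trans : ∀ {α β γ} → Cohomologous₂ M α β → Cohomologous₂ M β γ → Cohomologous₂ M α γ
  cohomologous-trans {α} {β} {γ} (f , αβ⁻¹≈δf) (f′ , βγ⁻¹≈δf′) = f ∙₁ f′ , λ g h →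
    let a = fun₂ α g h ; b = fun₂ β g h ; c = fun₂ γ g h in begin
    a ∙ c ⁻¹                          ≈⟨ identityʳ _ ⟨
    (a ∙ c ⁻¹) ∙ ε                    ≈⟨ ∙-congˡ (inverseˡ b) ⟨
    (a ∙ c ⁻¹) ∙ (b ⁻¹ ∙ b)           ≈⟨ solve 4 (λ a b b′ c′ → (a ⊕ c′) ⊕ (b′ ⊕ b) ⊜ (a ⊕ b′) ⊕ (b ⊕ c′))
                                               refl a b (b ⁻¹) (c ⁻¹) ⟩
    (a ∙ b ⁻¹) ∙ (b ∙ c ⁻¹)           ≈⟨ ∙-cong (αβ⁻¹≈δf g h) (βγ⁻¹≈δf′ g h) ⟩
    δ₁ M f g h ∙ δ₁ M f′ g h          ≈⟨ δ₁-homo f f′ g h ⟨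
    δ₁ M (f ∙₁ f′) g h                ∎

  IsNormalized₂ : Cochain₂ M → Set (c ⊔ ℓ′)
  IsNormalized₂ α = (∀ g → fun₂ α g G.ε ≈ ε) × (∀ h → fun₂ α G.ε h ≈ ε)

  module _ (β : Cochain₂ M) (β-cocycle : IsCocycle₂ M β) where

    private
      b = fun₂ β
      b₀ = b G.ε G.ε

    cocycle-εˡ : ∀ k → b G.ε k ≈ b₀
    cocycle-εˡ k = ∙-cancelˡ (b G.ε k) _ _ (begin
      b G.ε k ∙ b G.ε k                     ≈⟨ ∙-cong (·-ε _) (cong₂ β G.refl (G.identityˡ k)) ⟨
      (G.ε · b G.ε k) ∙ b G.ε (G.ε G.∙ k)   ≈⟨ β-cocycle G.ε G.ε k ⟩
      b (G.ε G.∙ G.ε) k ∙ b₀                ≈⟨ ∙-congʳ (cong₂ β (G.identityˡ G.ε) G.refl) ⟩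
      b G.ε k ∙ b₀                          ∎)

    cocycle-εʳ : ∀ g → b g G.ε ≈ g · b₀
    cocycle-εʳ g = sym (∙-cancelʳ (b g G.ε) _ _ (begin
      (g · b₀) ∙ b g G.ε                    ≈⟨ ∙-congˡ (cong₂ β G.refl (G.identityˡ G.ε)) ⟨
      (g · b₀) ∙ b g (G.ε G.∙ G.ε)          ≈⟨ β-cocycle g G.ε G.ε ⟩
      b (g G.∙ G.ε) G.ε ∙ b g G.ε           ≈⟨ ∙-congʳ (cong₂ β (G.identityʳ g) G.refl) ⟩
      b g G.ε ∙ b g G.ε                     ∎))

    normalization : Σ (Cochain₂ M) λ β′ → IsCocycle₂ M β′ × Cohomologous₂ M β′ β × IsNormalized₂ β′
    normalization =
      β′ , ∙₂-isCocycle β (coboundary₂ f) β-cocycle (coboundary₂-isCocycle f) ,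
      ∙₂coboundary-cohomologous β f ,
      (λ g → β′-trivial (cocycle-εʳ g)) ,
      (λ h → β′-trivial (trans (cocycle-εˡ h) (sym (·-ε b₀))))
      where
      f = const₁ (b₀ ⁻¹)
      β′ = β ∙₂ coboundary₂ f
      β′-trivial : ∀ {g h} → b g h ≈ g · b₀ → fun₂ β′ g h ≈ ε
      β′-trivial {g} {h} b≈g·b₀ = begin
        b g h ∙ δ₁ M f g h         ≈⟨ ∙-cong b≈g·b₀ (δ₁-const (b₀ ⁻¹) g h) ⟩
        (g · b₀) ∙ (g · (b₀ ⁻¹))   ≈⟨ ∙-congˡ (·-⁻¹-homo g b₀) ⟩
        (g · b₀) ∙ (g · b₀) ⁻¹     ≈⟨ inverseʳ _ ⟩
        ε                          ∎

module Transversal {c ℓ p : Level} {G : Group c ℓ} {N : Group.Carrier G → Set p}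
    (N-normal : IsNormalSubgroup G N)
    {s : Group.Carrier G → Group.Carrier G} (s-section : IsNormalizedSection G N s) where

  open Group G
  open GroupProperties G using (⁻¹-anti-homo-∙; ⁻¹-involutive; x≈y⇒x∙y⁻¹≈ε; //-rightDividesʳ)
  open IsNormalSubgroup N-normal
  open IsNormalizedSection s-section

  s-cong : ∀ {g h} → g ≈ h → s g ≈ s h
  s-cong {g} g≈h = well-defined (resp (sym (trans (∙-congˡ (sym g≈h)) (inverseˡ g))) ε-mem)

  s-idem : ∀ g → s (s g) ≈ s g
  s-idem g = well-defined (is-section g)

  s-N∙ : ∀ {n} → N n → ∀ g → s (n ∙ g) ≈ s g
  s-N∙ {n} n∈N g = well-defined (resp g⁻¹n⁻¹g≈[ng]⁻¹g (conj-mem (g ⁻¹) (⁻¹-mem n∈N)))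
    where
    g⁻¹n⁻¹g≈[ng]⁻¹g : g ⁻¹ ∙ n ⁻¹ ∙ g ⁻¹ ⁻¹ ≈ (n ∙ g) ⁻¹ ∙ g
    g⁻¹n⁻¹g≈[ng]⁻¹g = ∙-cong (sym (⁻¹-anti-homo-∙ n g)) (⁻¹-involutive g)

  s-N : ∀ {n} → N n → s n ≈ ε
  s-N {n} n∈N = begin
    s n        ≈⟨ s-cong (identityʳ n) ⟨
    s (n ∙ ε)  ≈⟨ s-N∙ n∈N ε ⟩
    s ε        ≈⟨ s-one ⟩
    ε          ∎
    where open SetoidReasoning setoid

  N-part : Carrier → Carrier
  N-part g = g ∙ s g ⁻¹

  N-part-cong : ∀ {g h} → g ≈ h → N-part g ≈ N-part h
  N-part-cong g≈h = ∙-cong g≈h (⁻¹-cong (s-cong g≈h))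

  N-part-s : ∀ g → N-part (s g) ≈ ε
  N-part-s g = x≈y⇒x∙y⁻¹≈ε (sym (s-idem g))

  N-part-N∙s : ∀ {n} → N n → ∀ g → N-part (n ∙ s g) ≈ n
  N-part-N∙s {n} n∈N g = begin
    (n ∙ s g) ∙ s (n ∙ s g) ⁻¹  ≈⟨ ∙-congˡ (⁻¹-cong (trans (s-N∙ n∈N (s g)) (s-idem g))) ⟩
    (n ∙ s g) ∙ s g ⁻¹          ≈⟨ //-rightDividesʳ (s g) n ⟩
    n                           ∎
    where open SetoidReasoning setoid

  module _ {c′ ℓ′ : Level} (M : GModule G c′ ℓ′) where

    open GModule M using (_·_)
    module A = AbelianGroup (GModule.A M)
    open Cohomology M using (_∙₂_; coboundary₂; IsNormalized₂; ·-ε-homo)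

    transversalCochain : Cochain₂ M → Cochain₁ M
    transversalCochain β = record
      { fun  = λ g → Cochain₂.fun β (N-part g) (s g)
      ; cong = λ g≈h → Cochain₂.cong β (N-part-cong g≈h) (s-cong g≈h)
      }

    ∙₂coboundary-transversal-vanishes : ∀ β → IsNormalized₂ β → ∀ {n} → N n → ∀ σ →
      Cochain₂.fun (β ∙₂ coboundary₂ (transversalCochain β)) n (s σ) A.≈ A.ε
    ∙₂coboundary-transversal-vanishes β (β-εʳ , β-εˡ) {n} n∈N σ = begin
      b n t A.∙ (((n · F t) A.∙ F (n ∙ t) A.⁻¹) A.∙ F n)
        ≈⟨ A.∙-congˡ (A.∙-cong (A.∙-cong n·F-t (A.⁻¹-cong F-nt)) F-n) ⟩
      b n t A.∙ ((A.ε A.∙ b n t A.⁻¹) A.∙ A.ε)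
        ≈⟨ A.∙-congˡ (A.trans (A.identityʳ _) (A.identityˡ _)) ⟩
      b n t A.∙ b n t A.⁻¹
        ≈⟨ A.inverseʳ _ ⟩
      A.ε
        ∎
      where
      open SetoidReasoning A.setoid
      open GModule M using (·-cong)
      b = Cochain₂.fun β
      F = Cochain₁.fun (transversalCochain β)
      t = s σ
      F-t : F t A.≈ A.ε
      F-t = A.trans (Cochain₂.cong β (N-part-s σ) refl) (β-εˡ (s t))
      n·F-t : n · F t A.≈ A.ε
      n·F-t = A.trans (·-cong refl F-t) (·-ε-homo n)
      F-n : F n A.≈ A.ε
      F-n = A.trans (Cochain₂.cong β refl (s-N n∈N)) (β-εʳ (N-part n))
      F-nt : F (n ∙ t) A.≈ b n t
      F-nt = Cochain₂.cong β (N-part-N∙s n∈N σ) (trans (s-N∙ n∈N t) (s-idem σ))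

lemma3p1 : ∀ {c ℓ p c′ ℓ′ : Level} (G : Group c ℓ) → IsFiniteGroup G →
    (N : Group.Carrier G → Set p) → IsNormalSubgroup G N →
    (s : Group.Carrier G → Group.Carrier G) → IsNormalizedSection G N s →
    (M : GModule G c′ ℓ′) →
    (β : Cochain₂ M) → IsCocycle₂ M β →
    Σ (Cochain₂ M) λ α → IsCocycle₂ M α × Cohomologous₂ M α β ×
    (∀ n σ → N n → AbelianGroup._≈_ (GModule.A M) (Cochain₂.fun α n (s σ)) (AbelianGroup.ε (GModule.A M)))
lemma3p1 G _ N N-normal s s-section M β β-cocycle =
  let β′ , β′-cocycle , β′∼β , β′-normalized = normalization β β-cocycle
      f = transversalCochain M β′
  in β′ ∙₂ coboundary₂ f ,
     ∙₂-isCocycle β′ (coboundary₂ f) β′-cocycle (coboundary₂-isCocycle f) ,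
     cohomologous-trans {β′ ∙₂ coboundary₂ f} {β′} {β} (∙₂coboundary-cohomologous β′ f) β′∼β ,
     λ n σ n∈N → ∙₂coboundary-transversal-vanishes M β′ β′-normalized n∈N σ
  where
  open Cohomology M
  open Transversal N-normal s-section
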